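{- Let $u, v \in \mathcal{A}_n^*$ be standard words such that $u \equiv_{\mathsf{sylv}} v$. Then $\mathrm{cochseq}(u) = \mathrm{cochseq}(v)$.
   Context: $\mathcal{A}_n = \{1<2<\cdots<n\}$. A word $u$ is standard if it contains each symbol of $\{1,\ldots,|u|\}$ exactly once. The sylvester congruence $\equiv_{\mathsf{sylv}}$ on $\mathcal{A}_n^*$ is the congruence generated by the relations $(cavb, acvb)$ for all $a,b,c \in \mathcal{A}_n$ with $a \leq b < c$ and all $v \in \mathcal{A}_n^*$ (equivalently, $u \equiv_{\mathsf{sylv}} v$ iff inserting the symbols of $u$ and of $v$, from right to left, into an initially empty right strict binary search tree — each node's label is $\geq$ all labels in its left subtree and $<$ all labels in its right subtree, new symbols added as leaves — gives the same tree). For a standard word $u$, the cocharge sequence $\mathrm{cochseq}(u)$ is computed as follows: write $u$ anticlockwise around a circle starting from a marked point $*$; label the symbol $1$ with $0$; after labelling $i$ with $k$, proceed clockwise from $i$ to the symbol $i+1$: if $i+1$ is reached before passing $*$, label it $k+1$, otherwise label it $k$. The $i$-th term of $\mathrm{cochseq}(u)$ is the label of $i$. -}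

module Defs where

open import Data.Nat using (ℕ; zero; suc; _+_; _≤_; _<_; _<ᵇ_; _≟_)
open import Data.List using (List; []; _∷_; _++_; length; map)
open import Data.List.Relation.Unary.All using (All)
open import Data.Product using (_×_)
open import Data.Bool using (if_then_else_)
open import Relation.Binary.PropositionalEquality using (_≡_)
import Relation.Nullary

InAlphabet : ℕ → ℕ → Set
InAlphabet n a = 1 ≤ a × a ≤ n

Word : Set
Word = List ℕ

IsWordOver : ℕ → Word → Set
IsWordOver n w = All (InAlphabet n) w

occ : ℕ → Word → ℕ
occ a [] = 0
occ a (x ∷ u) with x ≟ a
... | Relation.Nullary.yes _ = suc (occ a u)
... | Relation.Nullary.no _ = occ a u

IsStandard : Word → Set
IsStandard u = ∀ i → 1 ≤ i → i ≤ length u → occ i u ≡ 1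

data SylvGen (n : ℕ) : Word → Word → Set where
  rel : ∀ a b c (v : Word) → InAlphabet n a → InAlphabet n b → InAlphabet n c →
        IsWordOver n v → a ≤ b → b < c →
        SylvGen n (c ∷ a ∷ v ++ b ∷ []) (a ∷ c ∷ v ++ b ∷ [])

data _≡sylv[_]_ : Word → ℕ → Word → Set where
  gen   : ∀ {n} (l r : Word) {x y} → SylvGen n x y →
          (l ++ x ++ r) ≡sylv[ n ] (l ++ y ++ r)
  refl  : ∀ {n} {x} → x ≡sylv[ n ] x
  sym   : ∀ {n} {x y} → x ≡sylv[ n ] y → y ≡sylv[ n ] x
  trans : ∀ {n} {x y z} → x ≡sylv[ n ] y → y ≡sylv[ n ] z → x ≡sylv[ n ] z

-- 0-based position of (the first occurrence of) symbol a in u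
-- (returns length u if a does not occur).
pos : ℕ → Word → ℕ
pos a [] = 0
pos a (x ∷ u) with x ≟ a
... | Relation.Nullary.yes _ = 0
... | Relation.Nullary.no _ = suc (pos a u)

-- Cocharge labels.  u is written anticlockwise starting at the marked
-- point *, so u_1, u_2, ..., u_m appear anticlockwise after *.  Moving
-- clockwise from position p decreases the position; the marked point is
-- passed when wrapping from u_1 back to u_m.  Hence i+1 is reached from i
-- before passing * iff pos(i+1) < pos(i).
label : Word → ℕ → ℕ
label u zero = 0
label u (suc zero) = 0
label u (suc (suc i)) =
  if pos (suc (suc i)) u <ᵇ pos (suc i) u
  then suc (label u (suc i))
  else label u (suc i)

oneTo : ℕ → List ℕ
oneTo zero = []
oneTo (suc m) = oneTo m ++ (suc m ∷ [])

cochseq : Word → List ℕ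
cochseq u = map (label u) (oneTo (length u))

-- An adjacent swap c a ↦ a c only changes the relative order of the letters a and c, and
-- the cocharge labels only compare the positions of consecutive letters i, i+1.  In a
-- sylvester relation c a v b ≡ a c v b with a ≤ b < c the letters a, c are not consecutive
-- in a standard word: c = a + 1 would force b = a, so a would occur twice.  Since the
-- relations also permute letters, standardness is preserved along the congruence.
module Submission where

open import Defs
open import Data.Nat using (ℕ; zero; suc; _+_; _≤_; _<_; _<ᵇ_; _≟_; z≤n; s≤s)
open import Data.Nat.Properties
  using (+-commutativeSemigroup; ≤-refl; ≤-trans; ≤-antisym; ≤-pred; ≤-<-trans; <-irrefl; <⇒≱; n≤1+n; m≤n⇒m≤1+n; m≤m+n; m≤n+m)
open import Algebra.Properties.CommutativeSemigroup +-commutativeSemigroup using (x∙yz≈y∙xz)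
open import Data.Bool using (Bool; if_then_else_)
open import Data.List using ([]; _∷_; _++_; length; map)
open import Data.List.Properties using (map-cong-local)
open import Data.List.Relation.Unary.All as All using (All; []; _∷_)
open import Data.List.Relation.Unary.All.Properties using (++⁺)
open import Data.List.Relation.Binary.Permutation.Propositional using (_↭_; refl; prep; swap; trans; ↭-sym)
open import Data.List.Relation.Binary.Permutation.Propositional.Properties using (↭-length; ++⁺ˡ)
open import Data.Product using (_×_; _,_)
open import Data.Sum using (_⊎_; inj₁; inj₂)
open import Data.Empty using (⊥-elim)
open import Relation.Nullary using (yes; no; ¬_)
open import Relation.Binary.PropositionalEquality
  using (_≡_; _≢_; cong; cong₂; subst; module ≡-Reasoning)
  renaming (refl to ≡-refl; sym to ≡-sym; trans to ≡-trans)

private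
  variable
    s h x y a c : ℕ
    u w w₁ w₂ xs ys : Word

occ-here : ∀ s w → occ s (s ∷ w) ≡ suc (occ s w)
occ-here s w with s ≟ s
... | yes _  = ≡-refl
... | no s≢s = ⊥-elim (s≢s ≡-refl)

occ-++ : ∀ s (u w : Word) → occ s (u ++ w) ≡ occ s u + occ s w
occ-++ s []      w = ≡-refl
occ-++ s (h ∷ u) w with h ≟ s
... | yes _ = cong suc (occ-++ s u w)
... | no _  = occ-++ s u w

occ-++ˡ-≤ : ∀ s (u w : Word) → occ s u ≤ occ s (u ++ w)
occ-++ˡ-≤ s u w = subst (occ s u ≤_) (≡-sym (occ-++ s u w)) (m≤m+n _ _)

occ-++ʳ-≤ : ∀ s (u w : Word) → occ s w ≤ occ s (u ++ w)
occ-++ʳ-≤ s u w = subst (occ s w ≤_) (≡-sym (occ-++ s u w)) (m≤n+m _ _)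

occ-∷-cong : ∀ h → occ s xs ≡ occ s ys → occ s (h ∷ xs) ≡ occ s (h ∷ ys)
occ-∷-cong {s} h eq with h ≟ s
... | yes _ = cong suc eq
... | no _  = eq

occ-∷-swap : ∀ s x y w → occ s (x ∷ y ∷ w) ≡ occ s (y ∷ x ∷ w)
occ-∷-swap s x y w = begin
  occ s (x ∷ y ∷ w)          ≡⟨ occ-++ s (x ∷ []) (y ∷ w) ⟩
  ∣ x ∣ + occ s (y ∷ w)      ≡⟨ cong (∣ x ∣ +_) (occ-++ s (y ∷ []) w) ⟩
  ∣ x ∣ + (∣ y ∣ + occ s w)  ≡⟨ x∙yz≈y∙xz ∣ x ∣ ∣ y ∣ (occ s w) ⟩
  ∣ y ∣ + (∣ x ∣ + occ s w)  ≡⟨ cong (∣ y ∣ +_) (occ-++ s (x ∷ []) w) ⟨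
  ∣ y ∣ + occ s (x ∷ w)      ≡⟨ occ-++ s (y ∷ []) (x ∷ w) ⟨
  occ s (y ∷ x ∷ w)          ∎
  where
  open ≡-Reasoning
  ∣_∣ : ℕ → ℕ
  ∣ z ∣ = occ s (z ∷ [])

occ-↭ : xs ↭ ys → occ s xs ≡ occ s ys
occ-↭ refl                      = ≡-refl
occ-↭ (prep h p)                = occ-∷-cong h (occ-↭ p)
occ-↭ {s = s} (swap {xs} x y p) = ≡-trans (occ-∷-swap s x y xs) (occ-∷-cong y (occ-∷-cong x (occ-↭ p)))
occ-↭ (trans p q)               = ≡-trans (occ-↭ p) (occ-↭ q)

IsStandard-resp-↭ : xs ↭ ys → IsStandard xs → IsStandard ys
IsStandard-resp-↭ p std i 1≤i i≤len =
  ≡-trans (≡-sym (occ-↭ p)) (std i 1≤i (subst (i ≤_) (≡-sym (↭-length p)) i≤len))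

SylvGen⇒↭ : ∀ {n} (l r : Word) {u w} → SylvGen n u w → l ++ u ++ r ↭ l ++ w ++ r
SylvGen⇒↭ l r (rel a b c v _ _ _ _ _ _) = ++⁺ˡ l (swap c a refl)

≡sylv⇒↭ : ∀ {n} → u ≡sylv[ n ] w → u ↭ w
≡sylv⇒↭ (gen l r g) = SylvGen⇒↭ l r g
≡sylv⇒↭ refl        = refl
≡sylv⇒↭ (sym p)     = ↭-sym (≡sylv⇒↭ p)
≡sylv⇒↭ (trans p q) = trans (≡sylv⇒↭ p) (≡sylv⇒↭ q)

occursBefore : ℕ → ℕ → Word → Bool
occursBefore x y w = pos x w <ᵇ pos y w

Avoids : ℕ → ℕ → ℕ → Set
Avoids h x y = h ≢ x × h ≢ y

occursBefore-∷-cong : ∀ h → occursBefore x y w₁ ≡ occursBefore x y w₂ →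
                      occursBefore x y (h ∷ w₁) ≡ occursBefore x y (h ∷ w₂)
occursBefore-∷-cong {x} {y} h eq with h ≟ x | h ≟ y
... | yes _ | yes _ = ≡-refl
... | yes _ | no _  = ≡-refl
... | no _  | yes _ = ≡-refl
... | no _  | no _  = eq

occursBefore-++ˡ-cong : ∀ (l : Word) → occursBefore x y w₁ ≡ occursBefore x y w₂ →
                        occursBefore x y (l ++ w₁) ≡ occursBefore x y (l ++ w₂)
occursBefore-++ˡ-cong []      eq = eq
occursBefore-++ˡ-cong (h ∷ l) eq = occursBefore-∷-cong h (occursBefore-++ˡ-cong l eq)

occursBefore-∷-avoiding : Avoids h x y → occursBefore x y (h ∷ w) ≡ occursBefore x y w
occursBefore-∷-avoiding {h} {x} {y} (h≢x , h≢y) with h ≟ x | h ≟ y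
... | yes h≡x | _       = ⊥-elim (h≢x h≡x)
... | no _    | yes h≡y = ⊥-elim (h≢y h≡y)
... | no _    | no _    = ≡-refl

occursBefore-swap : Avoids c x y ⊎ Avoids a x y →
                    occursBefore x y (c ∷ a ∷ w) ≡ occursBefore x y (a ∷ c ∷ w)
occursBefore-swap {a = a} (inj₁ c-avoids) =
  ≡-trans (occursBefore-∷-avoiding c-avoids)
          (occursBefore-∷-cong a (≡-sym (occursBefore-∷-avoiding c-avoids)))
occursBefore-swap {c = c} (inj₂ a-avoids) =
  ≡-trans (occursBefore-∷-cong c (occursBefore-∷-avoiding a-avoids))
          (≡-sym (occursBefore-∷-avoiding a-avoids))

avoids-consecutive : ∀ i → a < c → ¬ (a ≡ suc i × c ≡ suc (suc i)) →
                     Avoids c (suc (suc i)) (suc i) ⊎ Avoids a (suc (suc i)) (suc i)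
avoids-consecutive {a} i a<c not-consecutive with a ≟ suc i | a ≟ suc (suc i)
... | yes ≡-refl | _ =
  inj₁ ((λ c≡2+i → not-consecutive (≡-refl , c≡2+i)) , λ { ≡-refl → <-irrefl ≡-refl a<c })
... | no _ | yes ≡-refl =
  inj₁ ((λ { ≡-refl → <-irrefl ≡-refl a<c }) , λ { ≡-refl → <⇒≱ a<c (n≤1+n _) })
... | no a≢1+i | no a≢2+i = inj₂ (a≢2+i , a≢1+i)

ConsecutiveOrderAgree : Word → Word → ℕ → Set
ConsecutiveOrderAgree u w k =
  ∀ i → suc (suc i) ≤ k → occursBefore (suc (suc i)) (suc i) u ≡ occursBefore (suc (suc i)) (suc i) w

label-cong : ∀ k → ConsecutiveOrderAgree u w k → label u k ≡ label w k
label-cong zero          _    = ≡-refl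
label-cong (suc zero)    _    = ≡-refl
label-cong (suc (suc i)) same =
  cong₂ (λ b k → if b then suc k else k)
        (same i ≤-refl)
        (label-cong (suc i) (λ j j≤ → same j (m≤n⇒m≤1+n j≤)))

oneTo-≤ : ∀ n → All (_≤ n) (oneTo n)
oneTo-≤ zero    = []
oneTo-≤ (suc n) = ++⁺ (All.map m≤n⇒m≤1+n (oneTo-≤ n)) (≤-refl ∷ [])

cochseq-cong : length u ≡ length w →
               ConsecutiveOrderAgree u w (length u) → cochseq u ≡ cochseq w
cochseq-cong {u} {w} len same =
  ≡-trans (map-cong-local (All.map (λ {k} k≤len → label-cong k (λ i i≤k → same i (≤-trans i≤k k≤len)))
                                   (oneTo-≤ (length u))))
          (cong (λ m → map (label w) (oneTo m)) len)

occ-repeated : ∀ (l : Word) c (v r : Word) → 2 ≤ occ a (l ++ c ∷ a ∷ (v ++ a ∷ []) ++ r)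
occ-repeated {a} l c v r = begin
  2                          ≡⟨ cong suc (occ-here a []) ⟨
  suc (occ a (a ∷ []))       ≤⟨ s≤s (occ-++ʳ-≤ a v (a ∷ [])) ⟩
  suc (occ a (v ++ a ∷ []))  ≤⟨ s≤s (occ-++ˡ-≤ a (v ++ a ∷ []) r) ⟩
  suc (occ a m)              ≡⟨ occ-here a m ⟨
  occ a (a ∷ m)              ≤⟨ occ-++ʳ-≤ a (c ∷ []) (a ∷ m) ⟩
  occ a (c ∷ a ∷ m)          ≤⟨ occ-++ʳ-≤ a l (c ∷ a ∷ m) ⟩
  occ a (l ++ c ∷ a ∷ m)     ∎
  where
  open Data.Nat.Properties.≤-Reasoning
  m = (v ++ a ∷ []) ++ r

standard-swap-not-consecutive : ∀ (l v r : Word) {a b c} → a ≤ b → b < c →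
  IsStandard (l ++ c ∷ a ∷ (v ++ b ∷ []) ++ r) →
  ∀ i → suc (suc i) ≤ length (l ++ c ∷ a ∷ (v ++ b ∷ []) ++ r) → ¬ (a ≡ suc i × c ≡ suc (suc i))
standard-swap-not-consecutive l v r a≤b b<c std i 2+i≤len (≡-refl , ≡-refl)
  rewrite ≤-antisym (≤-pred b<c) a≤b =
  <-irrefl ≡-refl (subst (2 ≤_) (std (suc i) (s≤s z≤n) (≤-trans (n≤1+n _) 2+i≤len))
                         (occ-repeated l (suc (suc i)) v r))

cochseq-resp-SylvGen : ∀ {n} (l r : Word) {u w} → SylvGen n u w →
                       IsStandard (l ++ u ++ r) → cochseq (l ++ u ++ r) ≡ cochseq (l ++ w ++ r)
cochseq-resp-SylvGen l r g@(rel a b c v _ _ _ _ a≤b b<c) std =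
  cochseq-cong (↭-length (SylvGen⇒↭ l r g)) λ i 2+i≤len →
    occursBefore-++ˡ-cong l (occursBefore-swap
      (avoids-consecutive i (≤-<-trans a≤b b<c) (standard-swap-not-consecutive l v r a≤b b<c std i 2+i≤len)))

cochseq-resp-≡sylv : ∀ {n} → u ≡sylv[ n ] w → IsStandard u → cochseq u ≡ cochseq w
cochseq-resp-≡sylv (gen l r g) std = cochseq-resp-SylvGen l r g std
cochseq-resp-≡sylv refl        std = ≡-refl
cochseq-resp-≡sylv (sym p)     std =
  ≡-sym (cochseq-resp-≡sylv p (IsStandard-resp-↭ (↭-sym (≡sylv⇒↭ p)) std))
cochseq-resp-≡sylv (trans p q) std =
  ≡-trans (cochseq-resp-≡sylv p std) (cochseq-resp-≡sylv q (IsStandard-resp-↭ (≡sylv⇒↭ p) std))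

proposition3p2 : (n : ℕ) (u v : Word) →
    IsWordOver n u → IsWordOver n v →
    IsStandard u → IsStandard v →
    u ≡sylv[ n ] v →
    cochseq u ≡ cochseq v
proposition3p2 n u v _ _ u-standard _ u≡v = cochseq-resp-≡sylv u≡v u-standard
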